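{- Let $G$ be an ordered abelian group, $p$ a prime, $H \in \mathcal{S}_p \setminus \{\emptyset\}$, and $r \geq 1$. Let $(a_i)_{i \in \mathbb{Q}}$ be an indiscernible sequence in $G$ (in the language $\{<,+\}$) such that $\mathfrak{s}_{p^r}(a_i) = H$ for all $i$ and $\mathfrak{s}_p(a_j - a_i) = H$ for all $i < j$ in $\mathbb{Q}$. Then every $a_i$ lies in $H^{[p^r]}$, and for any distinct $i_1,\dots,i_k \in \mathbb{Q}$ the following (equivalent) conditions hold: the images of $a_{i_1},\dots,a_{i_k}$ in $(H^{[p^r]}+pG)/(H+pG)$ are $\mathbb{F}_p$-linearly independent; their images in $H^{[p^r]}/(H+p^rG)$ are $(\mathbb{Z}/p^r\mathbb{Z})$-linearly independent; and for all integers $m_1,\dots,m_k$ with $\min\{v_p(m_1),\dots,v_p(m_k)\} < r$, $\mathfrak{s}_{p^r}(\sum_t m_t a_{i_t}) = H$.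
   Context: Convex subgroups of $G$ are ordered by inclusion, with $\emptyset$ below all. For $n\ge2$, $a\in G$: if $a\notin nG$, $\mathfrak{s}_n(a)$ is the largest convex subgroup $H$ with $a\notin H+nG$; else $\mathfrak{s}_n(a)=\emptyset$. $\mathcal{S}_n=\{\mathfrak{s}_n(a)\mid a\in G\}$. For convex $H$ and $m\ge 2$, $H^{[m]}=\bigcap_{H'\text{ convex}, H'\supsetneq H}(H'+mG)$. $v_p$ is the $p$-adic valuation on integers (with $v_p(0)=\infty$). -}

module Defs where

open import Level using (Level; 0ℓ) renaming (suc to lsuc)
open import Data.Nat as ℕ using (ℕ; zero; suc; _^_)
open import Data.Integer as ℤ using (ℤ; +_; -[1+_])
import Data.Integer.Divisibility as ℤd
open import Data.Fin as Fin using (Fin)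
open import Data.Rational as ℚ using (ℚ)
open import Data.Product using (Σ; ∃; _×_; _,_)
open import Data.Sum using (_⊎_)
open import Data.Empty using (⊥)
open import Function using (_∘_; _⇔_)
open import Relation.Nullary using (¬_)
open import Relation.Unary using (Pred; _∈_; _∉_; _⊆_)
open import Relation.Binary.PropositionalEquality using (_≡_)
open import Algebra.Structures using (IsAbelianGroup)
open import Relation.Binary.Structures using (IsStrictTotalOrder)

record OrderedAbelianGroup : Set₁ where
  infixl 6 _+_
  infix 4 _<_
  field
    Carrier : Set
    _+_     : Carrier → Carrier → Carrier
    0#      : Carrier
    -_      : Carrier → Carrier
    _<_     : Carrier → Carrier → Set
    isAbelianGroup    : IsAbelianGroup _≡_ _+_ 0# -_
    isStrictTotalOrder : IsStrictTotalOrder _≡_ _<_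
    +-mono-< : ∀ {x y} z → x < y → x + z < y + z

  _≤_ : Carrier → Carrier → Set
  x ≤ y = x < y ⊎ x ≡ y

module OAG (G : OrderedAbelianGroup) where
  open OrderedAbelianGroup G public

  _·ℕ_ : ℕ → Carrier → Carrier
  zero  ·ℕ x = 0#
  suc n ·ℕ x = x + (n ·ℕ x)

  _·ℤ_ : ℤ → Carrier → Carrier
  (+ n)      ·ℤ x = n ·ℕ x
  -[1+ n ]   ·ℤ x = - (suc n ·ℕ x)

  sumFin : (k : ℕ) → (Fin k → Carrier) → Carrier
  sumFin zero    f = 0#
  sumFin (suc k) f = f Fin.zero + sumFin k (f ∘ Fin.suc)

  Subset : Set₁
  Subset = Pred Carrier 0ℓ

  ∅ : Subset
  ∅ _ = ⊥

  _≐_ : Subset → Subset → Set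
  A ≐ B = (A ⊆ B) × (B ⊆ A)

  mulG : ℕ → Subset
  mulG n x = ∃ λ y → x ≡ n ·ℕ y

  _+mulG_ : Subset → ℕ → Subset
  (H +mulG n) x = ∃ λ h → ∃ λ y → h ∈ H × x ≡ h + (n ·ℕ y)

  record IsConvexSubgroup (H : Subset) : Set where
    field
      zero∈  : 0# ∈ H
      +-closed : ∀ {x y} → x ∈ H → y ∈ H → (x + y) ∈ H
      neg-closed : ∀ {x} → x ∈ H → (- x) ∈ H
      convex : ∀ {x y z} → x ∈ H → z ∈ H → x ≤ y → y ≤ z → y ∈ H

  -- "S = 𝔰_n(a)" (S is either ∅ or a convex subgroup)
  IsS : ℕ → Carrier → Subset → Set₁
  IsS n a S =
      (a ∈ mulG n × S ≐ ∅)
    ⊎ (a ∉ mulG n × IsConvexSubgroup S × a ∉ (S +mulG n)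
        × (∀ (H' : Subset) → IsConvexSubgroup H' → a ∉ (H' +mulG n) → H' ⊆ S))

  InSn : ℕ → Subset → Set₁
  InSn n S = ∃ λ a → IsS n a S

  bracket : Subset → ℕ → Pred Carrier (lsuc 0ℓ)
  bracket H m x = ∀ (H' : Subset) → IsConvexSubgroup H' → H ⊆ H' → ¬ (H' ⊆ H)
                  → x ∈ (H' +mulG m)

  data Term (n : ℕ) : Set where
    var  : Fin n → Term n
    _⊕_  : Term n → Term n → Term n

  data Formula : ℕ → Set where
    _≈ᶠ_ : ∀ {n} → Term n → Term n → Formula n
    _<ᶠ_ : ∀ {n} → Term n → Term n → Formula n
    ¬ᶠ_  : ∀ {n} → Formula n → Formula n
    _∧ᶠ_ : ∀ {n} → Formula n → Formula n → Formula n
    ∃ᶠ   : ∀ {n} → Formula (suc n) → Formula n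

  evalT : ∀ {n} → Term n → (Fin n → Carrier) → Carrier
  evalT (var i) ρ = ρ i
  evalT (s ⊕ t) ρ = evalT s ρ + evalT t ρ

  extend : ∀ {n} → Carrier → (Fin n → Carrier) → Fin (suc n) → Carrier
  extend x ρ Fin.zero    = x
  extend x ρ (Fin.suc i) = ρ i

  Sat : ∀ {n} → Formula n → (Fin n → Carrier) → Set
  Sat (s ≈ᶠ t) ρ = evalT s ρ ≡ evalT t ρ
  Sat (s <ᶠ t) ρ = evalT s ρ < evalT t ρ
  Sat (¬ᶠ φ)   ρ = ¬ Sat φ ρ
  Sat (φ ∧ᶠ ψ) ρ = Sat φ ρ × Sat ψ ρ
  Sat (∃ᶠ φ)   ρ = ∃ λ x → Sat φ (extend x ρ)

  StrictlyIncreasing : ∀ {k} → (Fin k → ℚ) → Set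
  StrictlyIncreasing {k} i = ∀ (s t : Fin k) → s Fin.< t → i s ℚ.< i t

  Indiscernible : (ℚ → Carrier) → Set
  Indiscernible a = ∀ (k : ℕ) (φ : Formula k) (i j : Fin k → ℚ)
    → StrictlyIncreasing i → StrictlyIncreasing j
    → Sat φ (a ∘ i) ⇔ Sat φ (a ∘ j)

-- p-adic valuation: "v_p(m) < r"  (v_p(0) = ∞, so this never holds for m = 0)

ValLt : ℕ → ℤ → ℕ → Set
ValLt p m r = ∃ λ e → (e ℕ.< r) × ((+ (p ^ e)) ℤd.∣ m) × ¬ ((+ (p ^ suc e)) ℤd.∣ m)

-- Put S = H + pG. For u < w we have H = 𝔰_p(a_w − a_u), which makes H, and hence S, definable in
-- {<, +} from a_u and a_w: g ∈ H iff |p·g| < |d| for every representative d of a_w − a_u modulo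
-- pG. (If g ∉ H, the convex subgroup generated by g is larger than H, so it contains such a
-- representative, which reduces modulo p·|g| into [−p·|g|, p·|g|].)
-- If Σ cₜ a_{iₜ} ∈ S with p ∤ c_{t₀}, indiscernibility moves i_{t₀} up to some q inside its gap
-- without leaving S; subtracting the two sums gives c_{t₀}·(a_{i_{t₀}} − a_q) ∈ S, hence
-- a_q − a_{i_{t₀}} ∈ S, contradicting 𝔰_p(a_q − a_{i_{t₀}}) = H.
-- Independence modulo p^r follows by dividing out one power of p at a time (H is convex, so
-- p^s·y ∈ H + p^{s+1}G gives y ∈ H + pG). Finally a combination with a coefficient of valuation
-- < r avoids H + p^rG, while every convex H' ⊋ H contains all a_i modulo p^rG because
-- H = 𝔰_{p^r}(a_i); so the combination has 𝔰_{p^r} equal to H.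

module Submission where

open import Defs
open import Level using (0ℓ) renaming (suc to lsuc)
open import Axiom.ExcludedMiddle using (ExcludedMiddle)
open import Data.Nat using (ℕ; _^_; _≥_)
open import Data.Nat.Primality using (Prime)
open import Data.Integer using (ℤ; +_)
import Data.Integer.Divisibility as ℤd
open import Data.Fin using (Fin)
open import Data.Rational using (ℚ)
open import Data.Product using (∃; _×_)
open import Function using (_∘_; Injective)
open import Relation.Unary using (_∈_; Satisfiable)
open import Relation.Binary.PropositionalEquality using (_≡_)

open import Level using (Lift; lift; lower)
open import Data.Nat as ℕ using (zero; suc; NonZero)
import Data.Nat.Properties as ℕP
import Data.Nat.Divisibility as ℕd
open import Data.Nat.Primality using (prime⇒irreducible; prime⇒nonZero)
open import Data.Nat.Coprimality using (Coprime; coprime-Bézout)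
open import Data.Nat.GCD using (module Bézout)
open import Data.Integer as ℤ using (-[1+_])
open import Data.Fin using (#_)
import Data.Fin as Fin
import Data.Fin.Properties as FinP
open import Data.Rational as ℚ using (0ℚ)
open import Data.Vec.Functional using ([]; _∷_; updateAt)
open import Data.Vec.Functional.Properties using (updateAt-updates; updateAt-minimal)
open import Data.Product using (_,_; proj₁; proj₂)
open import Data.Product.Function.NonDependent.Propositional using (_×-⇔_)
open import Data.Product.Function.Dependent.Propositional using (Σ-⇔)
open import Data.Sum using (_⊎_; inj₁; inj₂)
open import Data.Empty using (⊥-elim)
open import Function using (const; _⇔_; mk⇔; Equivalence)
open import Function.Construct.Identity using (⇔-id; ↠-id)
open import Function.Construct.Symmetry using (⇔-sym)
open import Function.Construct.Composition using (_⇔-∘_)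
open import Function.Related.TypeIsomorphisms using (¬-cong-⇔)
open import Relation.Nullary using (¬_; yes; no)
open import Relation.Nullary.Decidable using (map′)
open import Relation.Unary using (_⊆_; _∉_)
open import Relation.Binary.PropositionalEquality
  using (refl; sym; trans; cong; cong₂; subst; subst₂; module ≡-Reasoning)
open import Relation.Binary.Definitions using (tri<; tri≈; tri>)
open import Relation.Binary.Bundles using (DecTotalOrder)
open import Relation.Binary.Structures using (IsStrictTotalOrder)
open import Algebra.Bundles using (AbelianGroup)
open import Algebra.Structures using (IsAbelianGroup)

prime∤⇒coprime : ∀ {p m} → Prime p → ¬ p ℕd.∣ m → Coprime m p
prime∤⇒coprime p-prime p∤m (d∣m , d∣p) with prime⇒irreducible p-prime d∣p
... | inj₁ d≡1 = d≡1
... | inj₂ refl = ⊥-elim (p∤m d∣m)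

^-monoʳ-∣ : ∀ p {m n} → m ℕ.≤ n → p ^ m ℕd.∣ p ^ n
^-monoʳ-∣ p ℕ.z≤n       = ℕd.1∣ _
^-monoʳ-∣ p (ℕ.s≤s m≤n) = ℕd.*-monoʳ-∣ p (^-monoʳ-∣ p m≤n)

≡-cong-⇔ : ∀ {A : Set} {a b c : A} → a ≡ b → (a ≡ c) ⇔ (b ≡ c)
≡-cong-⇔ refl = ⇔-id _

module OrderedAbelianGroupProperties (G : OrderedAbelianGroup) where
  open OAG G hiding (_≤_)

  -- OAG._≤_, given a fixity (Defs declares none).
  infix 4 _≤_
  _≤_ : Carrier → Carrier → Set
  _≤_ = OAG._≤_ G

  open IsAbelianGroup isAbelianGroup public
    using (assoc; comm; identityˡ; identityʳ; inverseˡ; inverseʳ; _-_)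
  open IsStrictTotalOrder isStrictTotalOrder public
    using (irrefl; asym; compare; _<?_) renaming (trans to <-trans)

  abelianGroup : AbelianGroup 0ℓ 0ℓ
  abelianGroup = record { isAbelianGroup = isAbelianGroup }

  open import Algebra.Properties.AbelianGroup abelianGroup public
    using (⁻¹-involutive; ε⁻¹≈ε; ⁻¹-∙-comm)
  open import Algebra.Properties.CommutativeSemigroup
    (AbelianGroup.commutativeSemigroup abelianGroup) public
    using (interchange)

  open ≡-Reasoning

  x+y-y≡x : ∀ x y → x + y - y ≡ x
  x+y-y≡x x y = begin
    x + y - y     ≡⟨ assoc x y (- y) ⟩
    x + (y - y)   ≡⟨ cong (_+_ x) (inverseʳ y) ⟩
    x + 0#        ≡⟨ identityʳ x ⟩
    x             ∎

  x-y+y≡x : ∀ x y → x - y + y ≡ x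
  x-y+y≡x x y = begin
    x - y + y       ≡⟨ assoc x (- y) y ⟩
    x + (- y + y)   ≡⟨ cong (_+_ x) (inverseˡ y) ⟩
    x + 0#          ≡⟨ identityʳ x ⟩
    x               ∎

  -x+[x+v]≡v : ∀ x v → - x + (x + v) ≡ v
  -x+[x+v]≡v x v = begin
    - x + (x + v)   ≡⟨ assoc (- x) x v ⟨
    - x + x + v     ≡⟨ cong (_+ v) (inverseˡ x) ⟩
    0# + v          ≡⟨ identityˡ v ⟩
    v               ∎

  x+[-x+v]≡v : ∀ x v → x + (- x + v) ≡ v
  x+[-x+v]≡v x v = begin
    x + (- x + v)   ≡⟨ assoc x (- x) v ⟨
    x - x + v       ≡⟨ cong (_+ v) (inverseʳ x) ⟩
    0# + v          ≡⟨ identityˡ v ⟩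
    v               ∎

  y+[x+v]≡x+y+v : ∀ x y v → y + (x + v) ≡ x + y + v
  y+[x+v]≡x+y+v x y v = trans (sym (assoc y x v)) (cong (_+ v) (comm y x))

  -‿distrib-+ : ∀ x y → - (x + y) ≡ - x + - y
  -‿distrib-+ x y = sym (⁻¹-∙-comm x y)

  -‿anti-homo-- : ∀ x y → - (x - y) ≡ y - x
  -‿anti-homo-- x y = begin
    - (x - y)      ≡⟨ -‿distrib-+ x (- y) ⟩
    - x + - - y    ≡⟨ cong (_+_ (- x)) (⁻¹-involutive y) ⟩
    - x + y        ≡⟨ comm (- x) y ⟩
    y - x          ∎

  x+y+z≡x+z+y : ∀ x y z → x + y + z ≡ x + z + y
  x+y+z≡x+z+y x y z = begin
    x + y + z     ≡⟨ assoc x y z ⟩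
    x + (y + z)   ≡⟨ cong (_+_ x) (comm y z) ⟩
    x + (z + y)   ≡⟨ assoc x z y ⟨
    x + z + y     ∎

  x+l≡l+s⇔x≡s : ∀ {x l s} → x + l ≡ l + s ⇔ x ≡ s
  x+l≡l+s⇔x≡s {x} {l} {s} = mk⇔
    (λ x+l≡l+s → trans (sym (x+y-y≡x x l))
                       (trans (cong (_- l) (trans x+l≡l+s (comm l s))) (x+y-y≡x s l)))
    (λ { refl → comm x l })

  ≤-refl : ∀ {x} → x ≤ x
  ≤-refl = inj₂ refl

  ≮⇒≥ : ∀ {x y} → ¬ x < y → y ≤ x
  ≮⇒≥ {x} {y} x≮y with compare x y
  ... | tri< x<y _ _ = ⊥-elim (x≮y x<y)
  ... | tri≈ _ x≡y _ = inj₂ (sym x≡y)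
  ... | tri> _ _ y<x = inj₁ y<x

  ≤⇒≯ : ∀ {x y} → x ≤ y → ¬ y < x
  ≤⇒≯ (inj₁ x<y) y<x = asym x<y y<x
  ≤⇒≯ (inj₂ refl) x<x = irrefl refl x<x

  <-≤-trans : ∀ {x y z} → x < y → y ≤ z → x < z
  <-≤-trans x<y (inj₁ y<z) = <-trans x<y y<z
  <-≤-trans x<y (inj₂ refl) = x<y

  ≤-trans : ∀ {x y z} → x ≤ y → y ≤ z → x ≤ z
  ≤-trans (inj₁ x<y) y≤z = inj₁ (<-≤-trans x<y y≤z)
  ≤-trans (inj₂ refl) y≤z = y≤z

  +-monoʳ-≤ : ∀ {x y} z → x ≤ y → x + z ≤ y + z
  +-monoʳ-≤ z (inj₁ x<y) = inj₁ (+-mono-< z x<y)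
  +-monoʳ-≤ z (inj₂ refl) = ≤-refl

  +-monoˡ-< : ∀ {x y} z → x < y → z + x < z + y
  +-monoˡ-< {x} {y} z x<y = subst₂ _<_ (comm x z) (comm y z) (+-mono-< z x<y)

  +-monoˡ-≤ : ∀ {x y} z → x ≤ y → z + x ≤ z + y
  +-monoˡ-≤ z (inj₁ x<y) = inj₁ (+-monoˡ-< z x<y)
  +-monoˡ-≤ z (inj₂ refl) = ≤-refl

  +-mono-≤ : ∀ {x y u v} → x ≤ y → u ≤ v → x + u ≤ y + v
  +-mono-≤ {y = y} {u} x≤y u≤v = ≤-trans (+-monoʳ-≤ u x≤y) (+-monoˡ-≤ y u≤v)

  +-cancelʳ-< : ∀ {x y} z → x + z < y + z → x < y
  +-cancelʳ-< {x} {y} z lt = subst₂ _<_ (x+y-y≡x x z) (x+y-y≡x y z) (+-mono-< (- z) lt)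

  -‿anti-< : ∀ {x y} → x < y → - y < - x
  -‿anti-< {x} {y} x<y = +-cancelʳ-< (x + y) (subst₂ _<_ -y+[x+y]≡x (sym (-x+[x+v]≡v x y)) x<y)
    where
    -y+[x+y]≡x : x ≡ - y + (x + y)
    -y+[x+y]≡x = sym (trans (cong (_+_ (- y)) (comm x y)) (-x+[x+v]≡v y x))

  -‿anti-≤ : ∀ {x y} → x ≤ y → - y ≤ - x
  -‿anti-≤ (inj₁ x<y) = inj₁ (-‿anti-< x<y)
  -‿anti-≤ (inj₂ refl) = ≤-refl

  x<0⇒0<-x : ∀ {x} → x < 0# → 0# < - x
  x<0⇒0<-x x<0 = subst (_< _) ε⁻¹≈ε (-‿anti-< x<0)

  0<x⇒-x<0 : ∀ {x} → 0# < x → - x < 0#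
  0<x⇒-x<0 0<x = subst (_ <_) ε⁻¹≈ε (-‿anti-< 0<x)

  +-mono-<-⇔ : ∀ {x y} z → x < y ⇔ x + z < y + z
  +-mono-<-⇔ z = mk⇔ (+-mono-< z) (+-cancelʳ-< z)

  -x<y⇔v<x+y+v : ∀ x y v → - x < y ⇔ v < x + y + v
  -x<y⇔v<x+y+v x y v =
    subst₂ (λ l r → - x < y ⇔ l < r) (-x+[x+v]≡v x v) (y+[x+v]≡x+y+v x y v) (+-mono-<-⇔ (x + v))

  y<-x⇔x+y+v<v : ∀ x y v → y < - x ⇔ x + y + v < v
  y<-x⇔x+y+v<v x y v =
    subst₂ (λ l r → y < - x ⇔ l < r) (y+[x+v]≡x+y+v x y v) (-x+[x+v]≡v x v) (+-mono-<-⇔ (x + v))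

  ·ℕ-homo-+ : ∀ m n x → (m ℕ.+ n) ·ℕ x ≡ m ·ℕ x + n ·ℕ x
  ·ℕ-homo-+ zero    n x = sym (identityˡ _)
  ·ℕ-homo-+ (suc m) n x = trans (cong (_+_ x) (·ℕ-homo-+ m n x)) (sym (assoc x _ _))

  ·ℕ-distrib-+ : ∀ n x y → n ·ℕ (x + y) ≡ n ·ℕ x + n ·ℕ y
  ·ℕ-distrib-+ zero    x y = sym (identityˡ 0#)
  ·ℕ-distrib-+ (suc n) x y =
    trans (cong (_+_ (x + y)) (·ℕ-distrib-+ n x y)) (interchange x y _ _)

  ·ℕ-zeroʳ : ∀ n → n ·ℕ 0# ≡ 0#
  ·ℕ-zeroʳ zero    = refl
  ·ℕ-zeroʳ (suc n) = trans (cong (_+_ 0#) (·ℕ-zeroʳ n)) (identityˡ 0#)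

  ·ℕ-neg : ∀ n x → n ·ℕ (- x) ≡ - (n ·ℕ x)
  ·ℕ-neg zero    x = sym ε⁻¹≈ε
  ·ℕ-neg (suc n) x = trans (cong (_+_ (- x)) (·ℕ-neg n x)) (sym (-‿distrib-+ x _))

  ·ℕ-assoc : ∀ m n x → (m ℕ.* n) ·ℕ x ≡ m ·ℕ (n ·ℕ x)
  ·ℕ-assoc zero    n x = refl
  ·ℕ-assoc (suc m) n x = trans (·ℕ-homo-+ n (m ℕ.* n) x) (cong (_+_ (n ·ℕ x)) (·ℕ-assoc m n x))

  ·ℕ-nonneg : ∀ n {x} → 0# ≤ x → 0# ≤ n ·ℕ x
  ·ℕ-nonneg zero    0≤x = ≤-refl
  ·ℕ-nonneg (suc n) {x} 0≤x = subst (_≤ x + n ·ℕ x) (identityˡ 0#) (+-mono-≤ 0≤x (·ℕ-nonneg n 0≤x))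

  ·ℕ-monoˡ-≤ : ∀ {m n x} → 0# ≤ x → m ℕ.≤ n → m ·ℕ x ≤ n ·ℕ x
  ·ℕ-monoˡ-≤ {n = n} 0≤x ℕ.z≤n     = ·ℕ-nonneg n 0≤x
  ·ℕ-monoˡ-≤ {x = x} 0≤x (ℕ.s≤s m≤n) = +-monoˡ-≤ x (·ℕ-monoˡ-≤ 0≤x m≤n)

  x≤n·x : ∀ n .{{_ : NonZero n}} {x} → 0# ≤ x → x ≤ n ·ℕ x
  x≤n·x (suc n) {x} 0≤x = subst (_≤ x + n ·ℕ x) (identityʳ x) (+-monoˡ-≤ x (·ℕ-nonneg n 0≤x))

  ·ℤ-distrib-+ : ∀ c x y → c ·ℤ (x + y) ≡ c ·ℤ x + c ·ℤ y
  ·ℤ-distrib-+ (+ n)      x y = ·ℕ-distrib-+ n x y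
  ·ℤ-distrib-+ -[1+ n ]   x y = trans (cong -_ (·ℕ-distrib-+ (suc n) x y)) (-‿distrib-+ _ _)

  ·ℤ-neg : ∀ c x → c ·ℤ (- x) ≡ - (c ·ℤ x)
  ·ℤ-neg (+ n)      x = ·ℕ-neg n x
  ·ℤ-neg -[1+ n ]   x = cong -_ (·ℕ-neg (suc n) x)

  ·ℤ-distrib-- : ∀ c x y → c ·ℤ (x - y) ≡ c ·ℤ x - c ·ℤ y
  ·ℤ-distrib-- c x y = trans (·ℤ-distrib-+ c x (- y)) (cong (_+_ (c ·ℤ x)) (·ℤ-neg c y))

  ·ℤ-zeroʳ : ∀ c → c ·ℤ 0# ≡ 0#
  ·ℤ-zeroʳ c = begin
    c ·ℤ 0#              ≡⟨ cong (c ·ℤ_) (inverseʳ 0#) ⟨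
    c ·ℤ (0# - 0#)       ≡⟨ ·ℤ-distrib-- c 0# 0# ⟩
    c ·ℤ 0# - c ·ℤ 0#    ≡⟨ inverseʳ (c ·ℤ 0#) ⟩
    0#                   ∎

  sumFin-cong : ∀ k {f g : Fin k → Carrier} → (∀ t → f t ≡ g t) → sumFin k f ≡ sumFin k g
  sumFin-cong zero    f≗g = refl
  sumFin-cong (suc k) f≗g = cong₂ _+_ (f≗g Fin.zero) (sumFin-cong k (f≗g ∘ Fin.suc))

  sumFin-distrib-- : ∀ k (f g : Fin k → Carrier) →
                     sumFin k (λ t → f t - g t) ≡ sumFin k f - sumFin k g
  sumFin-distrib-- zero    f g = sym (inverseʳ 0#)
  sumFin-distrib-- (suc k) f g = begin
    f₀ - g₀ + sumFin k (λ t → f (Fin.suc t) - g (Fin.suc t))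
      ≡⟨ cong (_+_ (f₀ - g₀)) (sumFin-distrib-- k (f ∘ Fin.suc) (g ∘ Fin.suc)) ⟩
    f₀ - g₀ + (sumFin k (f ∘ Fin.suc) - sumFin k (g ∘ Fin.suc))
      ≡⟨ interchange f₀ (- g₀) _ _ ⟩
    f₀ + sumFin k (f ∘ Fin.suc) + (- g₀ + - sumFin k (g ∘ Fin.suc))
      ≡⟨ cong (_+_ (f₀ + _)) (-‿distrib-+ g₀ _) ⟨
    f₀ + sumFin k (f ∘ Fin.suc) - (g₀ + sumFin k (g ∘ Fin.suc))
      ∎
    where f₀ = f Fin.zero ; g₀ = g Fin.zero

  sumFin-zero : ∀ k (f : Fin k → Carrier) → (∀ t → f t ≡ 0#) → sumFin k f ≡ 0#
  sumFin-zero zero    f f≡0 = refl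
  sumFin-zero (suc k) f f≡0 =
    trans (cong₂ _+_ (f≡0 Fin.zero) (sumFin-zero k (f ∘ Fin.suc) (f≡0 ∘ Fin.suc))) (identityˡ 0#)

  sumFin-single : ∀ k (f : Fin k → Carrier) t₀ → (∀ t → ¬ t ≡ t₀ → f t ≡ 0#) →
                  sumFin k f ≡ f t₀
  sumFin-single (suc k) f Fin.zero f≡0 =
    trans (cong (_+_ (f Fin.zero)) (sumFin-zero k (f ∘ Fin.suc) (λ t → f≡0 (Fin.suc t) (λ ()))))
          (identityʳ _)
  sumFin-single (suc k) f (Fin.suc t₀) f≡0 =
    trans (cong₂ _+_ (f≡0 Fin.zero (λ ()))
                     (sumFin-single k (f ∘ Fin.suc) t₀ λ t t≢t₀ →
                        f≡0 (Fin.suc t) (t≢t₀ ∘ FinP.suc-injective)))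
          (identityˡ _)

  sumFin-·ℕ : ∀ n k (f : Fin k → Carrier) → sumFin k (λ t → n ·ℕ f t) ≡ n ·ℕ sumFin k f
  sumFin-·ℕ n zero    f = sym (·ℕ-zeroʳ n)
  sumFin-·ℕ n (suc k) f =
    trans (cong (_+_ (n ·ℕ f Fin.zero)) (sumFin-·ℕ n k (f ∘ Fin.suc))) (sym (·ℕ-distrib-+ n _ _))

  sumFin-·ℤ-difference : ∀ k (c : Fin k → ℤ) (f g : Fin k → Carrier) t₀ →
    (∀ t → ¬ t ≡ t₀ → f t ≡ g t) →
    sumFin k (λ t → c t ·ℤ f t) - sumFin k (λ t → c t ·ℤ g t) ≡ c t₀ ·ℤ (f t₀ - g t₀)
  sumFin-·ℤ-difference k c f g t₀ f≗g = begin
    sumFin k (λ t → c t ·ℤ f t) - sumFin k (λ t → c t ·ℤ g t)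
      ≡⟨ sumFin-distrib-- k _ _ ⟨
    sumFin k (λ t → c t ·ℤ f t - c t ·ℤ g t)
      ≡⟨ sumFin-cong k (λ t → ·ℤ-distrib-- (c t) (f t) (g t)) ⟨
    sumFin k (λ t → c t ·ℤ (f t - g t))
      ≡⟨ sumFin-single k _ t₀ (λ t t≢t₀ → trans (cong (λ v → c t ·ℤ (v - g t)) (f≗g t t≢t₀))
                                          (trans (cong (c t ·ℤ_) (inverseʳ (g t))) (·ℤ-zeroʳ (c t)))) ⟩
    c t₀ ·ℤ (f t₀ - g t₀)
      ∎

  ·ℤ-factor : ∀ n c → n ℕd.∣ ℤ.∣ c ∣ →
              ∃ λ e → ℤ.∣ c ∣ ≡ ℤ.∣ e ∣ ℕ.* n × ∀ x → c ·ℤ x ≡ n ·ℕ (e ·ℤ x)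
  ·ℤ-factor n (+ m)    (ℕd.divides q refl) = + q , refl , λ x → ·ℕ-comm-assoc q x
    where
    ·ℕ-comm-assoc : ∀ q x → (q ℕ.* n) ·ℕ x ≡ n ·ℕ (q ·ℕ x)
    ·ℕ-comm-assoc q x = trans (cong (_·ℕ x) (ℕP.*-comm q n)) (·ℕ-assoc n q x)
  ·ℤ-factor n -[1+ m ] (ℕd.divides (suc q) 1+m≡[1+q]n) =
    -[1+ q ] , 1+m≡[1+q]n , λ x → begin
      - (suc m ·ℕ x)               ≡⟨ cong (λ k → - (k ·ℕ x)) 1+m≡[1+q]n ⟩
      - ((suc q ℕ.* n) ·ℕ x)       ≡⟨ cong (λ v → - (v ·ℕ x)) (ℕP.*-comm (suc q) n) ⟩
      - ((n ℕ.* suc q) ·ℕ x)       ≡⟨ cong -_ (·ℕ-assoc n (suc q) x) ⟩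
      - (n ·ℕ (suc q ·ℕ x))        ≡⟨ ·ℕ-neg n _ ⟨
      n ·ℕ (- (suc q ·ℕ x))        ∎

module ConvexSubgroups (G : OrderedAbelianGroup) where
  open OAG G hiding (_≤_)
  open OrderedAbelianGroupProperties G

  Bounded : Carrier → Carrier → Set
  Bounded b x = - b ≤ x × x ≤ b

  Bounded-neg : ∀ {b x} → Bounded b x → Bounded b (- x)
  Bounded-neg {b} (-b≤x , x≤b) = -‿anti-≤ x≤b , subst (- _ ≤_) (⁻¹-involutive b) (-‿anti-≤ -b≤x)

  Bounded-+ : ∀ {a b x y} → Bounded a x → Bounded b y → Bounded (a + b) (x + y)
  Bounded-+ {a} {b} (-a≤x , x≤a) (-b≤y , y≤b) =
    subst (_≤ _) (sym (-‿distrib-+ a b)) (+-mono-≤ -a≤x -b≤y) , +-mono-≤ x≤a y≤b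

  Bounded-mono : ∀ {a b x} → a ≤ b → Bounded a x → Bounded b x
  Bounded-mono a≤b (-a≤x , x≤a) = ≤-trans (-‿anti-≤ a≤b) -a≤x , ≤-trans x≤a a≤b

  Within : Carrier → Carrier → Set
  Within e d = ¬ (e < d × - e < d) × ¬ (d < e × d < - e)

  Bounded⇒Within : ∀ {e d} → Bounded e d → Within e d
  Bounded⇒Within (-e≤d , d≤e) = (λ (e<d , _) → ≤⇒≯ d≤e e<d) , (λ (_ , d<-e) → ≤⇒≯ -e≤d d<-e)

  Bounded⁻⇒Within : ∀ {e d} → Bounded (- e) d → Within e d
  Bounded⁻⇒Within {e} (e≤d , d≤-e) =
    (λ (_ , -e<d) → ≤⇒≯ d≤-e -e<d) , (λ (d<e , _) → ≤⇒≯ (subst (_≤ _) (⁻¹-involutive e) e≤d) d<e)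

  module ConvexSubgroup {H : Subset} (cs : IsConvexSubgroup H) where
    open IsConvexSubgroup cs

    ·ℕ-closed : ∀ n {h} → h ∈ H → n ·ℕ h ∈ H
    ·ℕ-closed zero    h∈H = zero∈
    ·ℕ-closed (suc n) h∈H = +-closed h∈H (·ℕ-closed n h∈H)

    -‿closed⁻ : ∀ {x} → - x ∈ H → x ∈ H
    -‿closed⁻ {x} -x∈H = subst H (⁻¹-involutive x) (neg-closed -x∈H)

    ±-closed : ∀ {c g} → c ≡ g ⊎ c ≡ - g → g ∈ H → c ∈ H
    ±-closed (inj₁ refl) g∈H = g∈H
    ±-closed (inj₂ refl) g∈H = neg-closed g∈H

    Bounded-closed : ∀ {b x} → b ∈ H → Bounded b x → x ∈ H
    Bounded-closed b∈H (-b≤x , x≤b) = convex (neg-closed b∈H) b∈H -b≤x x≤b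

    ·ℕ-closed⁻ : ∀ n .{{_ : NonZero n}} {w} → n ·ℕ w ∈ H → w ∈ H
    ·ℕ-closed⁻ n {w} nw∈H with compare w 0#
    ... | tri< w<0 _ _  = -‿closed⁻ (nonneg (inj₁ (x<0⇒0<-x w<0))
                                      (subst H (sym (·ℕ-neg n w)) (neg-closed nw∈H)))
      where
      nonneg : ∀ {v} → 0# ≤ v → n ·ℕ v ∈ H → v ∈ H
      nonneg 0≤v nv∈H = convex zero∈ nv∈H 0≤v (x≤n·x n 0≤v)
    ... | tri≈ _ refl _ = zero∈
    ... | tri> _ _ 0<w  = convex zero∈ nw∈H (inj₁ 0<w) (x≤n·x n (inj₁ 0<w))

    Within-closed : ∀ {e d} → e ∈ H → Within e d → d ∈ H
    Within-closed {e} {d} e∈H (¬above , ¬below) with upper-bound ¬above | lower-bound ¬below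
      where
      upper-bound : ¬ (e < d × - e < d) → ∃ λ u → u ∈ H × d ≤ u
      upper-bound ¬above with e <? d
      ... | no e≮d  = e , e∈H , ≮⇒≥ e≮d
      ... | yes e<d = - e , neg-closed e∈H , ≮⇒≥ (λ -e<d → ¬above (e<d , -e<d))
      lower-bound : ¬ (d < e × d < - e) → ∃ λ l → l ∈ H × l ≤ d
      lower-bound ¬below with d <? e
      ... | no d≮e  = e , e∈H , ≮⇒≥ d≮e
      ... | yes d<e = - e , neg-closed e∈H , ≮⇒≥ (λ d<-e → ¬below (d<e , d<-e))
    ... | u , u∈H , d≤u | l , l∈H , l≤d = convex l∈H u∈H l≤d d≤u

    positive-representative : ∀ {g} → g ∉ H → ∃ λ c → 0# < c × c ∉ H × (c ≡ g ⊎ c ≡ - g)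
    positive-representative {g} g∉H with compare g 0#
    ... | tri< g<0 _ _  = - g , x<0⇒0<-x g<0 , g∉H ∘ -‿closed⁻ , inj₂ refl
    ... | tri≈ _ refl _ = ⊥-elim (g∉H zero∈)
    ... | tri> _ _ 0<g  = g , 0<g , g∉H , inj₁ refl

    ∉⇒bounds : ∀ {c h} → 0# < c → c ∉ H → h ∈ H → Bounded c h
    ∉⇒bounds {c} 0<c c∉H h∈H =
      ≮⇒≥ (λ h<-c → c∉H (-‿closed⁻ (convex h∈H zero∈ (inj₁ h<-c) (inj₁ (0<x⇒-x<0 0<c))))) ,
      ≮⇒≥ (λ c<h → c∉H (convex zero∈ h∈H (inj₁ 0<c) (inj₁ c<h)))

  ⊆-of-witness : ∀ {H H' g} → IsConvexSubgroup H → IsConvexSubgroup H' →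
                 g ∈ H' → g ∉ H → H ⊆ H'
  ⊆-of-witness {H} {H'} cs cs' g∈H' g∉H h∈H with ConvexSubgroup.positive-representative cs g∉H
  ... | c , 0<c , c∉H , c≡±g = ConvexSubgroup.Bounded-closed cs'
    (ConvexSubgroup.±-closed cs' c≡±g g∈H') (ConvexSubgroup.∉⇒bounds cs 0<c c∉H h∈H)

  hull : Carrier → Subset
  hull c x = ∃ λ N → Bounded (N ·ℕ c) x

  hull-isConvexSubgroup : ∀ {c} → 0# ≤ c → IsConvexSubgroup (hull c)
  hull-isConvexSubgroup {c} 0≤c = record
    { zero∈      = 0 , subst (_≤ 0#) (sym ε⁻¹≈ε) ≤-refl , ≤-refl
    ; +-closed   = λ (M , Mx) (N , Ny) →
        M ℕ.+ N , subst (λ b → Bounded b _) (sym (·ℕ-homo-+ M N c)) (Bounded-+ Mx Ny)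
    ; neg-closed = λ (N , Nx) → N , Bounded-neg Nx
    ; convex     = λ (M , -Mc≤x , _) (N , _ , z≤Nc) x≤y y≤z → M ℕ.+ N ,
        ≤-trans (-‿anti-≤ (·ℕ-monoˡ-≤ 0≤c (ℕP.m≤m+n M N))) (≤-trans -Mc≤x x≤y) ,
        ≤-trans y≤z (≤-trans z≤Nc (·ℕ-monoˡ-≤ 0≤c (ℕP.m≤n+m N M)))
    }

  ∈hull : ∀ {c} → 0# ≤ c → c ∈ hull c
  ∈hull {c} 0≤c = 1 , subst (λ b → Bounded b c) (sym (identityʳ c)) (-c≤c , ≤-refl)
    where
    -c≤c : - c ≤ c
    -c≤c = ≤-trans (subst (- c ≤_) ε⁻¹≈ε (-‿anti-≤ 0≤c)) 0≤c

  -- Division with remainder by n·c inside the archimedean class of c.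
  module _ (n : ℕ) .{{_ : NonZero n}} {c : Carrier} (0<c : 0# < c) where
    open ≡-Reasoning

    private
      0≤nc : 0# ≤ n ·ℕ c
      0≤nc = ·ℕ-nonneg n (inj₁ 0<c)

      shift-down : ∀ N {h} → n ·ℕ c < h → h ≤ suc N ·ℕ c → Bounded (N ·ℕ c) (h + n ·ℕ (- c))
      shift-down N {h} nc<h h≤c+Nc rewrite ·ℕ-neg n c =
        ≤-trans (subst (- (N ·ℕ c) ≤_) ε⁻¹≈ε (-‿anti-≤ (·ℕ-nonneg N (inj₁ 0<c))))
                (inj₁ (subst (_< h - n ·ℕ c) (inverseʳ (n ·ℕ c)) (+-mono-< (- (n ·ℕ c)) nc<h))) ,
        ≤-trans (+-monoʳ-≤ (- (n ·ℕ c)) (≤-trans h≤c+Nc (+-monoʳ-≤ (N ·ℕ c) (x≤n·x n (inj₁ 0<c)))))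
                (inj₂ (trans (cong (_- n ·ℕ c) (comm (n ·ℕ c) (N ·ℕ c))) (x+y-y≡x (N ·ℕ c) (n ·ℕ c))))

      in-range : ∀ {h} → Bounded (n ·ℕ c) h → ∃ λ z → Bounded (n ·ℕ c) (h + n ·ℕ z)
      in-range {h} b = 0# , subst (Bounded _) (sym h+n·0≡h) b
        where
        h+n·0≡h : h + n ·ℕ 0# ≡ h
        h+n·0≡h = trans (cong (_+_ h) (·ℕ-zeroʳ n)) (identityʳ h)

      shifted : ∀ {h} w → (∃ λ z → Bounded (n ·ℕ c) (h + n ·ℕ w + n ·ℕ z)) →
                ∃ λ z → Bounded (n ·ℕ c) (h + n ·ℕ z)
      shifted {h} w (z , b) = w + z , subst (Bounded _) h+nw+nz≡h+n[w+z] b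
        where
        h+nw+nz≡h+n[w+z] : h + n ·ℕ w + n ·ℕ z ≡ h + n ·ℕ (w + z)
        h+nw+nz≡h+n[w+z] = trans (assoc h _ _) (cong (_+_ h) (sym (·ℕ-distrib-+ n w z)))

    bounded-representative : ∀ N {h} → Bounded (N ·ℕ c) h → ∃ λ z → Bounded (n ·ℕ c) (h + n ·ℕ z)
    bounded-representative zero    b = in-range (Bounded-mono 0≤nc b)
    bounded-representative (suc N) {h} b with n ·ℕ c <? h | h <? - (n ·ℕ c)
    ... | yes nc<h | _ = shifted (- c) (bounded-representative N (shift-down N nc<h (proj₂ b)))
    ... | no _ | yes h<-nc = shifted c (bounded-representative N (subst (Bounded _) -[-h-nc]≡h+nc
          (Bounded-neg (shift-down N (subst (_< - h) (⁻¹-involutive _) (-‿anti-< h<-nc))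
                                 (proj₂ (Bounded-neg b))))))
      where
      -[-h-nc]≡h+nc : - (- h + n ·ℕ (- c)) ≡ h + n ·ℕ c
      -[-h-nc]≡h+nc = begin
        - (- h + n ·ℕ (- c))      ≡⟨ -‿distrib-+ (- h) _ ⟩
        - - h + - (n ·ℕ (- c))    ≡⟨ cong₂ _+_ (⁻¹-involutive h) (cong -_ (·ℕ-neg n c)) ⟩
        h + - - (n ·ℕ c)          ≡⟨ cong (_+_ h) (⁻¹-involutive _) ⟩
        h + n ·ℕ c                ∎
    ... | no nc≮h | no h≮-nc = in-range (≮⇒≥ h≮-nc , ≮⇒≥ nc≮h)

  module H+nG {H : Subset} (cs : IsConvexSubgroup H) (n : ℕ) where
    open IsConvexSubgroup cs renaming (+-closed to +-closedᴴ; neg-closed to neg-closedᴴ)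

    H⊆ : H ⊆ H +mulG n
    H⊆ {h} h∈H = h , 0# , h∈H , sym (trans (cong (_+_ h) (·ℕ-zeroʳ n)) (identityʳ h))

    mul∈ : ∀ y → n ·ℕ y ∈ H +mulG n
    mul∈ y = 0# , y , zero∈ , sym (identityˡ _)

    +-closed : ∀ {x y} → x ∈ H +mulG n → y ∈ H +mulG n → x + y ∈ H +mulG n
    +-closed (h , y , h∈H , refl) (h' , y' , h'∈H , refl) =
      h + h' , y + y' , +-closedᴴ h∈H h'∈H ,
      trans (interchange h _ h' _) (cong (_+_ (h + h')) (sym (·ℕ-distrib-+ n y y')))

    neg-closed : ∀ {x} → x ∈ H +mulG n → - x ∈ H +mulG n
    neg-closed (h , y , h∈H , refl) =
      - h , - y , neg-closedᴴ h∈H , trans (-‿distrib-+ h _) (cong (_+_ (- h)) (sym (·ℕ-neg n y)))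

    cancelʳ : ∀ {x y} → x + y ∈ H +mulG n → y ∈ H +mulG n → x ∈ H +mulG n
    cancelʳ {x} {y} x+y∈ y∈ = subst (H +mulG n) (x+y-y≡x x y) (+-closed x+y∈ (neg-closed y∈))

    ·ℕ-closed : ∀ m {x} → x ∈ H +mulG n → m ·ℕ x ∈ H +mulG n
    ·ℕ-closed zero    x∈ = H⊆ zero∈
    ·ℕ-closed (suc m) x∈ = +-closed x∈ (·ℕ-closed m x∈)

    ·ℤ-closed : ∀ c {x} → x ∈ H +mulG n → c ·ℤ x ∈ H +mulG n
    ·ℤ-closed (+ m)    x∈ = ·ℕ-closed m x∈
    ·ℤ-closed -[1+ m ] x∈ = neg-closed (·ℕ-closed (suc m) x∈)

    sumFin-closed : ∀ k (f : Fin k → Carrier) → (∀ t → f t ∈ H +mulG n) → sumFin k f ∈ H +mulG n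
    sumFin-closed zero    f f∈ = H⊆ zero∈
    sumFin-closed (suc k) f f∈ = +-closed (f∈ Fin.zero) (sumFin-closed k (f ∘ Fin.suc) (f∈ ∘ Fin.suc))

    ·ℕ-cancel : ∀ m .{{_ : NonZero m}} {y} → m ·ℕ y ∈ H +mulG (m ℕ.* n) → y ∈ H +mulG n
    ·ℕ-cancel m {y} (h , z , h∈H , my≡h+mnz) =
      y - n ·ℕ z , z , ConvexSubgroup.·ℕ-closed⁻ cs m (subst H (sym m[y-nz]≡h) h∈H) ,
      sym (x-y+y≡x y (n ·ℕ z))
      where
      open ≡-Reasoning
      m[y-nz]≡h : m ·ℕ (y - n ·ℕ z) ≡ h
      m[y-nz]≡h = begin
        m ·ℕ (y - n ·ℕ z)              ≡⟨ ·ℕ-distrib-+ m y _ ⟩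
        m ·ℕ y + m ·ℕ (- (n ·ℕ z))     ≡⟨ cong (_+_ (m ·ℕ y)) (·ℕ-neg m _) ⟩
        m ·ℕ y - m ·ℕ (n ·ℕ z)         ≡⟨ cong (λ v → m ·ℕ y - v) (·ℕ-assoc m n z) ⟨
        m ·ℕ y - (m ℕ.* n) ·ℕ z        ≡⟨ cong (_- (m ℕ.* n) ·ℕ z) my≡h+mnz ⟩
        h + (m ℕ.* n) ·ℕ z - (m ℕ.* n) ·ℕ z ≡⟨ x+y-y≡x h _ ⟩
        h                              ∎

    ∣·∣-closed : ∀ c {x} → c ·ℤ x ∈ H +mulG n → ℤ.∣ c ∣ ·ℕ x ∈ H +mulG n
    ∣·∣-closed (+ m)    cx∈ = cx∈
    ∣·∣-closed -[1+ m ] cx∈ = subst (H +mulG n) (⁻¹-involutive _) (neg-closed cx∈)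

    coprime-cancel : Prime n → ∀ {c x} → ¬ n ℕd.∣ ℤ.∣ c ∣ → c ·ℤ x ∈ H +mulG n → x ∈ H +mulG n
    coprime-cancel n-prime {c} {x} n∤c cx∈ =
      from-identity (coprime-Bézout (prime∤⇒coprime n-prime n∤c))
      where
      ∣c∣x∈ : ℤ.∣ c ∣ ·ℕ x ∈ H +mulG n
      ∣c∣x∈ = ∣·∣-closed c cx∈
      mul-c : ∀ a → (a ℕ.* ℤ.∣ c ∣) ·ℕ x ∈ H +mulG n
      mul-c a = subst (H +mulG n) (sym (·ℕ-assoc a _ x)) (·ℕ-closed a ∣c∣x∈)
      mul-n : ∀ b → (b ℕ.* n) ·ℕ x ∈ H +mulG n
      mul-n b = subst (H +mulG n) (sym (·ℕ-assoc b n x)) (·ℕ-closed b (mul∈ x))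
      one-more : ∀ {M N} → 1 ℕ.+ M ≡ N → M ·ℕ x ∈ H +mulG n → N ·ℕ x ∈ H +mulG n → x ∈ H +mulG n
      one-more refl Mx∈ [1+M]x∈ = cancelʳ [1+M]x∈ Mx∈
      from-identity : Bézout.Identity 1 ℤ.∣ c ∣ n → x ∈ H +mulG n
      from-identity (Bézout.+- a b 1+bn≡ac) = one-more 1+bn≡ac (mul-n b) (mul-c a)
      from-identity (Bézout.-+ a b 1+ac≡bn) = one-more 1+ac≡bn (mul-c a) (mul-n b)

  +mulG-∣ : ∀ {H m n} → m ℕd.∣ n → H +mulG n ⊆ H +mulG m
  +mulG-∣ {m = m} (ℕd.divides q refl) (h , y , h∈H , x≡h+qmy) =
    h , q ·ℕ y , h∈H ,
    trans x≡h+qmy (cong (_+_ h) (trans (cong (_·ℕ y) (ℕP.*-comm q m)) (·ℕ-assoc m q y)))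

  record IsLargestAvoiding (n : ℕ) (x : Carrier) (H : Subset) : Set₁ where
    field
      isConvexSubgroup : IsConvexSubgroup H
      avoids           : x ∉ H +mulG n
      largest          : ∀ H' → IsConvexSubgroup H' → x ∉ H' +mulG n → H' ⊆ H

  IsS⇒IsLargestAvoiding : ∀ {n x H} → Satisfiable H → IsS n x H → IsLargestAvoiding n x H
  IsS⇒IsLargestAvoiding (h , h∈H) (inj₁ (_ , H≐∅))                = ⊥-elim (proj₁ H≐∅ h∈H)
  IsS⇒IsLargestAvoiding _         (inj₂ (_ , cs , avoids , largest)) = record
    { isConvexSubgroup = cs ; avoids = avoids ; largest = largest }

  IsLargestAvoiding⇒IsS : ∀ {n x H} → IsLargestAvoiding n x H → IsS n x H
  IsLargestAvoiding⇒IsS {n} {x} {H} L = inj₂ (x∉nG , isConvexSubgroup , avoids , largest)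
    where
    open IsLargestAvoiding L
    x∉nG : x ∉ mulG n
    x∉nG (y , x≡ny) = avoids (subst (H +mulG n) (sym x≡ny) (H+nG.mul∈ isConvexSubgroup n y))

module Formulas (G : OrderedAbelianGroup) where
  open OAG G hiding (_≤_)
  open OrderedAbelianGroupProperties G

  renameᵗ : ∀ {m k} → (Fin m → Fin k) → Term m → Term k
  renameᵗ f (var i) = var (f i)
  renameᵗ f (s ⊕ t) = renameᵗ f s ⊕ renameᵗ f t

  rename : ∀ {m k} → (Fin m → Fin k) → Formula m → Formula k
  rename f (s ≈ᶠ t) = renameᵗ f s ≈ᶠ renameᵗ f t
  rename f (s <ᶠ t) = renameᵗ f s <ᶠ renameᵗ f t
  rename f (¬ᶠ φ)   = ¬ᶠ rename f φ
  rename f (φ ∧ᶠ ψ) = rename f φ ∧ᶠ rename f ψ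
  rename f (∃ᶠ φ)   = ∃ᶠ (rename (Fin.lift 1 f) φ)

  evalT-rename : ∀ {m k} (f : Fin m → Fin k) t {ρ σ} → (∀ i → ρ (f i) ≡ σ i) →
                 evalT (renameᵗ f t) ρ ≡ evalT t σ
  evalT-rename f (var i) ρ≗σ = ρ≗σ i
  evalT-rename f (s ⊕ t) ρ≗σ = cong₂ _+_ (evalT-rename f s ρ≗σ) (evalT-rename f t ρ≗σ)

  Sat-rename : ∀ {m k} (f : Fin m → Fin k) φ {ρ σ} → (∀ i → ρ (f i) ≡ σ i) →
               Sat (rename f φ) ρ ⇔ Sat φ σ
  Sat-rename f (s ≈ᶠ t) ρ≗σ =
    subst₂ (λ a b → _ ⇔ (a ≡ b)) (evalT-rename f s ρ≗σ) (evalT-rename f t ρ≗σ) (⇔-id _)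
  Sat-rename f (s <ᶠ t) ρ≗σ =
    subst₂ (λ a b → _ ⇔ (a < b)) (evalT-rename f s ρ≗σ) (evalT-rename f t ρ≗σ) (⇔-id _)
  Sat-rename f (¬ᶠ φ)   ρ≗σ = ¬-cong-⇔ (Sat-rename f φ ρ≗σ)
  Sat-rename f (φ ∧ᶠ ψ) ρ≗σ = Sat-rename f φ ρ≗σ ×-⇔ Sat-rename f ψ ρ≗σ
  Sat-rename f (∃ᶠ φ) {ρ} {σ} ρ≗σ = Σ-⇔ (↠-id _) (λ {x} → Sat-rename (Fin.lift 1 f) φ (extend-≗ x))
    where
    extend-≗ : ∀ x i → extend x ρ (Fin.lift 1 f i) ≡ extend x σ i
    extend-≗ x Fin.zero    = refl
    extend-≗ x (Fin.suc i) = ρ≗σ i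

  infixl 6 _+ᵗ_·_

  _+ᵗ_·_ : ∀ {j} → Term j → ℕ → Term j → Term j
  t +ᵗ zero  · v = t
  t +ᵗ suc m · v = (t +ᵗ m · v) ⊕ v

  evalT-+ᵗ· : ∀ {j} (t : Term j) m v ρ → evalT (t +ᵗ m · v) ρ ≡ evalT t ρ + m ·ℕ evalT v ρ
  evalT-+ᵗ· t zero    v ρ = sym (identityʳ _)
  evalT-+ᵗ· t (suc m) v ρ = begin
    evalT (t +ᵗ m · v) ρ + evalT v ρ        ≡⟨ cong (_+ evalT v ρ) (evalT-+ᵗ· t m v ρ) ⟩
    evalT t ρ + m ·ℕ evalT v ρ + evalT v ρ  ≡⟨ x+y+z≡x+z+y _ _ _ ⟩
    evalT t ρ + evalT v ρ + m ·ℕ evalT v ρ  ≡⟨ assoc _ _ _ ⟩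
    evalT t ρ + suc m ·ℕ evalT v ρ          ∎
    where open ≡-Reasoning

  _·ᵗ_ : ∀ {j} (n : ℕ) .{{_ : NonZero n}} → Term j → Term j
  suc n ·ᵗ v = v +ᵗ n · v

  evalT-·ᵗ : ∀ {j} n .{{_ : NonZero n}} (v : Term j) ρ → evalT (n ·ᵗ v) ρ ≡ n ·ℕ evalT v ρ
  evalT-·ᵗ (suc n) v ρ = evalT-+ᵗ· v n v ρ

  add-termᵗ : ∀ {j} → ℤ → Term j → Term j × Term j → Term j × Term j
  add-termᵗ (+ m)    v (l , r) = l , r +ᵗ m · v
  add-termᵗ -[1+ m ] v (l , r) = l +ᵗ suc m · v , r

  -- The language has no negation, so Σ cᵢ·vᵢ is represented by a pair (l , r) with
  -- r = l + Σ cᵢ·vᵢ, each coefficient being added on the side where it is a natural number.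
  combinationᵗ : ∀ {j} → Term j → ∀ k → (Fin k → ℤ) → (Fin k → Term j) → Term j × Term j
  combinationᵗ t zero    c v = t , t
  combinationᵗ t (suc k) c v =
    add-termᵗ (c Fin.zero) (v Fin.zero) (combinationᵗ t k (c ∘ Fin.suc) (v ∘ Fin.suc))

  evalT-add-termᵗ : ∀ {j} c (v : Term j) l r ρ {s} → evalT r ρ ≡ evalT l ρ + s →
    let (l' , r') = add-termᵗ c v (l , r) in evalT r' ρ ≡ evalT l' ρ + (c ·ℤ evalT v ρ + s)
  evalT-add-termᵗ (+ m) v l r ρ {s} r≡l+s = begin
    evalT (r +ᵗ m · v) ρ               ≡⟨ evalT-+ᵗ· r m v ρ ⟩
    evalT r ρ + m ·ℕ evalT v ρ         ≡⟨ cong (_+ _) r≡l+s ⟩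
    evalT l ρ + s + m ·ℕ evalT v ρ     ≡⟨ assoc _ s _ ⟩
    evalT l ρ + (s + m ·ℕ evalT v ρ)   ≡⟨ cong (_+_ (evalT l ρ)) (comm s _) ⟩
    evalT l ρ + (m ·ℕ evalT v ρ + s)   ∎
    where open ≡-Reasoning
  evalT-add-termᵗ -[1+ m ] v l r ρ {s} r≡l+s = begin
    evalT r ρ                          ≡⟨ r≡l+s ⟩
    evalT l ρ + s                      ≡⟨ cong (_+_ (evalT l ρ)) (x+[-x+v]≡v M s) ⟨
    evalT l ρ + (M + (- M + s))        ≡⟨ assoc _ M _ ⟨
    evalT l ρ + M + (- M + s)          ≡⟨ cong (_+ (- M + s)) (evalT-+ᵗ· l (suc m) v ρ) ⟨
    evalT (l +ᵗ suc m · v) ρ + (- M + s) ∎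
    where
    open ≡-Reasoning
    M : Carrier
    M = suc m ·ℕ evalT v ρ

  evalT-combinationᵗ : ∀ {j} (t : Term j) k c v ρ → let (l , r) = combinationᵗ t k c v in
    evalT r ρ ≡ evalT l ρ + sumFin k (λ i → c i ·ℤ evalT (v i) ρ)
  evalT-combinationᵗ t zero    c v ρ = sym (identityʳ _)
  evalT-combinationᵗ t (suc k) c v ρ =
    evalT-add-termᵗ (c Fin.zero) (v Fin.zero) _ _ ρ
                    (evalT-combinationᵗ t k (c ∘ Fin.suc) (v ∘ Fin.suc) ρ)

module IncreasingTuples where
  open import Data.Rational using (_<_; _≤_; _+_; _⊔_; 1ℚ)
  import Data.Rational.Properties as ℚP
  open import Data.List using (List; lookup; tabulate)
  import Data.List.Relation.Unary.All as All
  open import Data.List.Relation.Unary.AllPairs as AllPairs using (AllPairs)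
  open import Data.List.Relation.Unary.Any using (Any; index)
  open import Data.List.Relation.Unary.Any.Properties using (lookup-index)
  open import Data.List.Membership.Propositional.Properties using (∈-lookup; ∈-tabulate⁺)
  open import Data.List.Relation.Unary.Unique.Propositional.Properties using (tabulate⁺)
  open import Data.List.Relation.Unary.Sorted.TotalOrder.Properties using (Sorted⇒AllPairs)
  import Data.List.Relation.Binary.Permutation.Setoid.Properties as Permutationₛ
  import Data.List.Sort as Sort
  open import Relation.Binary.PropositionalEquality using (≢-sym) renaming (setoid to ≡-setoid)

  open Sort ℚP.≤-decTotalOrder using (sort; sort-↗; sortingAlgorithm; SortingAlgorithm)
  open SortingAlgorithm sortingAlgorithm using (sort-↭ₛ)
  open Permutationₛ (≡-setoid ℚ) using (Unique-resp-↭; ∈-resp-↭)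
  open import Data.List.Relation.Binary.Permutation.Setoid (≡-setoid ℚ) using (↭-sym)

  -- StrictlyIncreasing of Defs, which is only in scope inside the module OAG.
  Increasing : ∀ {m} → (Fin m → ℚ) → Set
  Increasing s = ∀ x y → x Fin.< y → s x < s y

  x<x+1 : ∀ x → x < x + 1ℚ
  x<x+1 x = subst (_< x + 1ℚ) (ℚP.+-identityʳ x) (ℚP.+-monoʳ-< x (ℚP.positive⁻¹ 1ℚ))

  upper-bound : ∀ {k} (ι : Fin k → ℚ) → ∃ λ u → ∀ t → ι t < u
  upper-bound {zero}  ι = 0ℚ , λ ()
  upper-bound {suc k} ι with upper-bound (ι ∘ Fin.suc)
  ... | b , ι<b = (ι Fin.zero ⊔ b) + 1ℚ , λ where
    Fin.zero    → ℚP.≤-<-trans (ℚP.p≤p⊔q _ b) (x<x+1 _)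
    (Fin.suc t) → ℚP.<-trans (ℚP.<-≤-trans (ι<b t) (ℚP.p≤q⊔p (ι Fin.zero) b)) (x<x+1 _)

  two-points-above : ∀ {k} (ι : Fin k → ℚ) → Injective _≡_ _≡_ ι →
                     ∃ λ u → ∃ λ w → u < w × Injective _≡_ _≡_ (u ∷ w ∷ ι)
  two-points-above ι ι-injective =
    u , u + 1ℚ , x<x+1 u ,
    ∷-injective (λ where Fin.zero    → ℚP.<⇒≢ (x<x+1 u)
                         (Fin.suc t) → ≢-sym (ℚP.<⇒≢ (ι<u t)))
                (∷-injective (λ t → ≢-sym (ℚP.<⇒≢ (ℚP.<-trans (ι<u t) (x<x+1 u)))) ι-injective)
    where
    u : ℚ
    u = proj₁ (upper-bound ι)
    ι<u : ∀ t → ι t < u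
    ι<u = proj₂ (upper-bound ι)
    ∷-injective : ∀ {m x} {f : Fin m → ℚ} → (∀ t → ¬ x ≡ f t) → Injective _≡_ _≡_ f →
                  Injective _≡_ _≡_ (x ∷ f)
    ∷-injective x∉f f-injective {Fin.zero}  {Fin.zero}  _     = refl
    ∷-injective x∉f f-injective {Fin.zero}  {Fin.suc j} x≡fj  = ⊥-elim (x∉f j x≡fj)
    ∷-injective x∉f f-injective {Fin.suc i} {Fin.zero}  fi≡x  = ⊥-elim (x∉f i (sym fi≡x))
    ∷-injective x∉f f-injective {Fin.suc i} {Fin.suc j} fi≡fj = cong Fin.suc (f-injective fi≡fj)

  gap-above : ∀ q {m} (s : Fin m → ℚ) → ∃ λ q' → q < q' × ∀ j → q < s j → q' < s j
  gap-above q {zero}  s = q + 1ℚ , x<x+1 q , λ ()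
  gap-above q {suc m} s with gap-above q (s ∘ Fin.suc)
  ... | q' , q<q' , above with q ℚP.<? s Fin.zero
  ...   | no q≮s₀ = q' , q<q' , λ where
          Fin.zero q<s₀ → ⊥-elim (q≮s₀ q<s₀)
          (Fin.suc j)   → above j
  ...   | yes q<s₀ with q' ℚP.<? s Fin.zero
  ...     | yes q'<s₀ = q' , q<q' , λ where
            Fin.zero _ → q'<s₀
            (Fin.suc j) → above j
  ...     | no q'≮s₀ = let r , q<r , r<s₀ = ℚP.<-dense q<s₀ in r , q<r , λ where
            Fin.zero _ → r<s₀
            (Fin.suc j) q<sj → ℚP.<-trans (ℚP.<-≤-trans r<s₀ (ℚP.≮⇒≥ q'≮s₀)) (above j q<sj)

  updateAt-increasing : ∀ {m} {s : Fin m → ℚ} → Increasing s → ∀ i {q} → s i < q →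
                        (∀ j → s i < s j → q < s j) → Increasing (updateAt s i (const q))
  updateAt-increasing {s = s} s↗ i {q} sᵢ<q gap x y x<y with x Fin.≟ i | y Fin.≟ i
  ... | yes refl | yes refl = ⊥-elim (FinP.<-irrefl refl x<y)
  ... | yes refl | no y≢i =
    subst₂ _<_ (sym (updateAt-updates i s)) (sym (updateAt-minimal y i s y≢i)) (gap y (s↗ i y x<y))
  ... | no x≢i | yes refl =
    subst₂ _<_ (sym (updateAt-minimal x i s x≢i)) (sym (updateAt-updates i s))
               (ℚP.<-trans (s↗ x i x<y) sᵢ<q)
  ... | no x≢i | no y≢i   =
    subst₂ _<_ (sym (updateAt-minimal x i s x≢i)) (sym (updateAt-minimal y i s y≢i)) (s↗ x y x<y)

  ≤∧≢⇒< : ∀ {x y} → x ≤ y → ¬ x ≡ y → x < y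
  ≤∧≢⇒< {x} {y} x≤y x≢y with ℚP.<-cmp x y
  ... | tri< x<y _ _ = x<y
  ... | tri≈ _ x≡y _ = ⊥-elim (x≢y x≡y)
  ... | tri> _ _ y<x = ⊥-elim (ℚP.<-irrefl refl (ℚP.<-≤-trans y<x x≤y))

  lookup-AllPairs : ∀ {A : Set} {R : A → A → Set} {xs} → AllPairs R xs →
                    ∀ {i j} → i Fin.< j → R (lookup xs i) (lookup xs j)
  lookup-AllPairs (AllPairs._∷_ Rx _)   {Fin.zero}  {Fin.suc j} _           = All.lookup Rx (∈-lookup j)
  lookup-AllPairs (AllPairs._∷_ _ Rxs) {Fin.suc i} {Fin.suc j} (ℕ.s≤s i<j) = lookup-AllPairs Rxs i<j

  record IncreasingEnumeration {k} (ι : Fin k → ℚ) : Set where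
    field
      m     : ℕ
      s     : Fin m → ℚ
      s↗    : Increasing s
      π     : Fin k → Fin m
      ι≡s∘π : ∀ t → ι t ≡ s (π t)

  increasing-enumeration : ∀ {k} (ι : Fin k → ℚ) → Injective _≡_ _≡_ ι → IncreasingEnumeration ι
  increasing-enumeration ι ι-injective = record
    { s = lookup L ; s↗ = λ _ _ → lookup-AllPairs L-strict
    ; π = index ∘ ι∈L ; ι≡s∘π = lookup-index ∘ ι∈L }
    where
    L : List ℚ
    L = sort (tabulate ι)
    L-strict : AllPairs _<_ L
    L-strict = AllPairs.zipWith (λ (x≤y , x≢y) → ≤∧≢⇒< x≤y x≢y)
      ( Sorted⇒AllPairs (DecTotalOrder.totalOrder ℚP.≤-decTotalOrder) (sort-↗ _)
      , Unique-resp-↭ (↭-sym (sort-↭ₛ _)) (tabulate⁺ ι-injective) )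
    ι∈L : ∀ t → Any (ι t ≡_) L
    ι∈L t = ∈-resp-↭ (↭-sym (sort-↭ₛ _)) (∈-tabulate⁺ t)

  record SameOrderType {k} (ι κ : Fin k → ℚ) : Set where
    field
      m      : ℕ
      π      : Fin k → Fin m
      s s'   : Fin m → ℚ
      s↗     : Increasing s
      s'↗    : Increasing s'
      ι≡s∘π  : ∀ t → ι t ≡ s (π t)
      κ≡s'∘π : ∀ t → κ t ≡ s' (π t)

  move-up : ∀ {k} (ι : Fin k → ℚ) → Injective _≡_ _≡_ ι → ∀ t₀ →
            ∃ λ q → ι t₀ < q × SameOrderType ι (updateAt ι t₀ (const q))
  move-up ι ι-injective t₀ = q , ιt₀<q , record
    { m = m ; π = π ; s = s ; s' = updateAt s (π t₀) (const q) ; s↗ = s↗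
    ; s'↗ = updateAt-increasing s↗ (π t₀) (subst (_< q) (ι≡s∘π t₀) ιt₀<q)
                                  (λ j → gap j ∘ subst (_< s j) (sym (ι≡s∘π t₀)))
    ; ι≡s∘π = ι≡s∘π ; κ≡s'∘π = κ≡s'∘π }
    where
    open IncreasingEnumeration (increasing-enumeration ι ι-injective)
    q : ℚ
    q = proj₁ (gap-above (ι t₀) s)
    ιt₀<q : ι t₀ < q
    ιt₀<q = proj₁ (proj₂ (gap-above (ι t₀) s))
    gap : ∀ j → ι t₀ < s j → q < s j
    gap = proj₂ (proj₂ (gap-above (ι t₀) s))

    κ≡s'∘π : ∀ t → updateAt ι t₀ (const q) t ≡ updateAt s (π t₀) (const q) (π t)
    κ≡s'∘π t with t Fin.≟ t₀
    ... | yes refl = trans (updateAt-updates t₀ ι) (sym (updateAt-updates (π t₀) s))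
    ... | no t≢t₀  = trans (updateAt-minimal t t₀ ι t≢t₀)
                           (trans (ι≡s∘π t) (sym (updateAt-minimal (π t) (π t₀) s πt≢πt₀)))
      where
      πt≢πt₀ : ¬ π t ≡ π t₀
      πt≢πt₀ πt≡πt₀ =
        t≢t₀ (ι-injective (trans (ι≡s∘π t) (trans (cong s πt≡πt₀) (sym (ι≡s∘π t₀)))))

module Definability (em : ExcludedMiddle 0ℓ) (G : OrderedAbelianGroup) where
  open OAG G hiding (_≤_)
  open OrderedAbelianGroupProperties G
  open ConvexSubgroups G

  -- A first-order description of 𝔰ₙ(W − U) in terms of U and W (see ∈⇔InH).
  InH : ℕ → Carrier → Carrier → Carrier → Set
  InH n U W g = ¬ ∃ λ y → ∃ λ d → d + U + n ·ℕ y ≡ W × Within (n ·ℕ g) d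

  module _ (n : ℕ) .{{_ : NonZero n}} {H : Subset} {U W : Carrier}
           (L : IsLargestAvoiding n (W - U) H) where
    open IsLargestAvoiding L
    open ConvexSubgroup isConvexSubgroup
    open ≡-Reasoning

    private
      W-U≡d+ny : ∀ {d y} → d + U + n ·ℕ y ≡ W → W - U ≡ d + n ·ℕ y
      W-U≡d+ny {d} {y} refl = trans (cong (_- U) (x+y+z≡x+z+y d U _)) (x+y-y≡x _ U)

      representative : ∀ {h y z} → W - U ≡ h + n ·ℕ y → h + n ·ℕ z + U + n ·ℕ (y - z) ≡ W
      representative {h} {y} {z} W-U≡h+ny = begin
        h + n ·ℕ z + U + n ·ℕ (y - z)     ≡⟨ x+y+z≡x+z+y _ U _ ⟩
        h + n ·ℕ z + n ·ℕ (y - z) + U     ≡⟨ cong (_+ U) (assoc h _ _) ⟩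
        h + (n ·ℕ z + n ·ℕ (y - z)) + U   ≡⟨ cong (λ v → h + v + U) (·ℕ-distrib-+ n z _) ⟨
        h + n ·ℕ (z + (y - z)) + U        ≡⟨ cong (λ v → h + n ·ℕ v + U) z+[y-z]≡y ⟩
        h + n ·ℕ y + U                    ≡⟨ cong (_+ U) W-U≡h+ny ⟨
        W - U + U                         ≡⟨ x-y+y≡x W U ⟩
        W                                 ∎
        where
        z+[y-z]≡y : z + (y - z) ≡ y
        z+[y-z]≡y = trans (comm z _) (x-y+y≡x y z)

      within : ∀ {c g d} → c ≡ g ⊎ c ≡ - g → Bounded (n ·ℕ c) d → Within (n ·ℕ g) d
      within (inj₁ refl) b = Bounded⇒Within b
      within {d = d} (inj₂ refl) b = Bounded⁻⇒Within (subst (λ e → Bounded e d) (·ℕ-neg n _) b)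

      ∉⇒within-representative : ∀ {g} → g ∉ H →
        ∃ λ y → ∃ λ d → d + U + n ·ℕ y ≡ W × Within (n ·ℕ g) d
      ∉⇒within-representative g∉H with positive-representative g∉H
      ... | c , 0<c , c∉H , c≡±g with em {W - U ∈ hull c +mulG n}
      ...   | no W-U∉ = ⊥-elim (c∉H (largest (hull c) (hull-isConvexSubgroup (inj₁ 0<c)) W-U∉
                                             (∈hull (inj₁ 0<c))))
      ...   | yes (h , y , (N , h∈) , W-U≡h+ny) with bounded-representative n 0<c N h∈
      ...     | z , b = y - z , h + n ·ℕ z , representative W-U≡h+ny , within c≡±g b

    ∈⇔InH : ∀ {g} → g ∈ H ⇔ InH n U W g
    ∈⇔InH {g} = mk⇔ ∈⇒InH InH⇒∈
      where
      ∈⇒InH : g ∈ H → InH n U W g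
      ∈⇒InH g∈H (y , d , eq , d-within) =
        avoids (d , y , Within-closed (·ℕ-closed n g∈H) d-within , W-U≡d+ny eq)
      InH⇒∈ : InH n U W g → g ∈ H
      InH⇒∈ ¬rep with em {g ∈ H}
      ... | yes g∈H = g∈H
      ... | no g∉H  = ⊥-elim (¬rep (∉⇒within-representative g∉H))

  open Formulas G

  -- The variable v stands in for the constant 0, which the language lacks: - e < d iff v < e + d + v.
  Withinᶠ : ∀ {j} → Term j → Term j → Term j → Formula j
  Withinᶠ e d v = (¬ᶠ ((e <ᶠ d) ∧ᶠ (v <ᶠ ((e ⊕ d) ⊕ v))))
               ∧ᶠ (¬ᶠ ((d <ᶠ e) ∧ᶠ (((e ⊕ d) ⊕ v) <ᶠ v)))

  Sat-Withinᶠ : ∀ {j} (e d v : Term j) ρ {e'} → evalT e ρ ≡ e' →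
                Sat (Withinᶠ e d v) ρ ⇔ Within e' (evalT d ρ)
  Sat-Withinᶠ e d v ρ refl = ¬-cong-⇔ (⇔-id _ ×-⇔ ⇔-sym (-x<y⇔v<x+y+v _ _ _))
                    ×-⇔ ¬-cong-⇔ (⇔-id _ ×-⇔ ⇔-sym (y<-x⇔x+y+v<v _ _ _))

  InHᶠ : (n : ℕ) .{{_ : NonZero n}} → Formula 3
  InHᶠ n = ¬ᶠ ∃ᶠ (∃ᶠ ((((d ⊕ U) +ᵗ n · y) ≈ᶠ W) ∧ᶠ Withinᶠ (n ·ᵗ g) d U))
    where
    d y g U W : Term 5
    d = var (# 0) ; y = var (# 1) ; g = var (# 2) ; U = var (# 3) ; W = var (# 4)

  Sat-InHᶠ : ∀ n .{{_ : NonZero n}} ρ → Sat (InHᶠ n) ρ ⇔ InH n (ρ (# 1)) (ρ (# 2)) (ρ (# 0))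
  Sat-InHᶠ n ρ = ¬-cong-⇔ (Σ-⇔ (↠-id _) λ {y} → Σ-⇔ (↠-id _) λ {d} →
    let ρ' = extend d (extend y ρ) in
    ≡-cong-⇔ (evalT-+ᵗ· (var (# 0) ⊕ var (# 3)) n (var (# 1)) ρ') ×-⇔
    Sat-Withinᶠ (n ·ᵗ var (# 2)) (var (# 0)) (var (# 3)) ρ' (evalT-·ᵗ n (var (# 2)) ρ'))

  ∈H+nGᶠ : (n : ℕ) .{{_ : NonZero n}} → Formula 3
  ∈H+nGᶠ n = ∃ᶠ (∃ᶠ (((g +ᵗ n · z) ≈ᶠ x) ∧ᶠ rename (# 0 ∷ # 3 ∷ # 4 ∷ []) (InHᶠ n)))
    where
    g z x : Term 5
    g = var (# 0) ; z = var (# 1) ; x = var (# 2)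

  Sat-∈H+nGᶠ : ∀ n .{{_ : NonZero n}} {H} ρ → IsLargestAvoiding n (ρ (# 2) - ρ (# 1)) H →
               Sat (∈H+nGᶠ n) ρ ⇔ ρ (# 0) ∈ H +mulG n
  Sat-∈H+nGᶠ n {H} ρ L = reorder ⇔-∘ Σ-⇔ (↠-id _) λ {z} → Σ-⇔ (↠-id _) λ {g} →
    let ρ' = extend g (extend z ρ) in
    ≡-cong-⇔ (evalT-+ᵗ· (var (# 0)) n (var (# 1)) ρ') ×-⇔
    (⇔-sym (∈⇔InH n L) ⇔-∘ (Sat-InHᶠ n (ρ' ∘ (# 0 ∷ # 3 ∷ # 4 ∷ []))
                          ⇔-∘ Sat-rename (# 0 ∷ # 3 ∷ # 4 ∷ []) (InHᶠ n) λ _ → refl))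
    where
    reorder : ∀ {x} → (∃ λ z → ∃ λ g → g + n ·ℕ z ≡ x × g ∈ H) ⇔ x ∈ H +mulG n
    reorder = mk⇔ (λ (z , g , eq , g∈H) → g , z , g∈H , sym eq)
                  (λ (g , z , g∈H , eq) → z , g , sym eq , g∈H)

  combinationᶠ : (n : ℕ) .{{_ : NonZero n}} → ∀ k → (Fin k → ℤ) → Formula (2 ℕ.+ k)
  combinationᶠ n k c =
    ∃ᶠ (((var (# 0) ⊕ proj₁ lr) ≈ᶠ proj₂ lr) ∧ᶠ rename (# 0 ∷ # 1 ∷ # 2 ∷ []) (∈H+nGᶠ n))
    where lr = combinationᵗ (var (# 1)) k c (λ t → var (Fin.suc (Fin.suc (Fin.suc t))))

  Sat-combinationᶠ : ∀ n .{{_ : NonZero n}} {H} k c ρ → IsLargestAvoiding n (ρ (# 1) - ρ (# 0)) H →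
    Sat (combinationᶠ n k c) ρ ⇔ sumFin k (λ t → c t ·ℤ ρ (Fin.suc (Fin.suc t))) ∈ H +mulG n
  Sat-combinationᶠ n {H} k c ρ L = the-sum ⇔-∘ Σ-⇔ (↠-id _) λ {x} → equation x ×-⇔ membership x
    where
    lr : Term (3 ℕ.+ k) × Term (3 ℕ.+ k)
    lr = combinationᵗ (var (# 1)) k c (λ t → var (Fin.suc (Fin.suc (Fin.suc t))))
    s : Carrier
    s = sumFin k (λ t → c t ·ℤ ρ (Fin.suc (Fin.suc t)))

    equation : ∀ x → (x + evalT (proj₁ lr) (extend x ρ) ≡ evalT (proj₂ lr) (extend x ρ)) ⇔ (x ≡ s)
    equation x = subst (λ r → (x + evalT (proj₁ lr) (extend x ρ) ≡ r) ⇔ (x ≡ s))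
                       (sym (evalT-combinationᵗ (var (# 1)) k c _ (extend x ρ))) x+l≡l+s⇔x≡s

    membership : ∀ x → Sat (rename (# 0 ∷ # 1 ∷ # 2 ∷ []) (∈H+nGᶠ n)) (extend x ρ) ⇔ x ∈ H +mulG n
    membership x = Sat-∈H+nGᶠ n (extend x ρ ∘ (# 0 ∷ # 1 ∷ # 2 ∷ [])) L
               ⇔-∘ Sat-rename (# 0 ∷ # 1 ∷ # 2 ∷ []) (∈H+nGᶠ n) λ _ → refl

    the-sum : (∃ λ x → x ≡ s × x ∈ H +mulG n) ⇔ s ∈ H +mulG n
    the-sum = mk⇔ (λ { (_ , refl , s∈) → s∈ }) (λ s∈ → _ , refl , s∈)

module Indiscernibility (G : OrderedAbelianGroup) where
  open OAG G hiding (_≤_)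
  open Formulas G
  open IncreasingTuples

  Indiscernible⇒SameOrderType⇒⇔ : ∀ {a} → Indiscernible a → ∀ {k} {ι κ : Fin k → ℚ} →
    SameOrderType ι κ → ∀ φ → Sat φ (a ∘ ι) ⇔ Sat φ (a ∘ κ)
  Indiscernible⇒SameOrderType⇒⇔ {a} indiscernible same φ =
    Sat-rename π φ (λ t → cong a (sym (κ≡s'∘π t))) ⇔-∘
    (indiscernible m (rename π φ) s s' s↗ s'↗ ⇔-∘
     ⇔-sym (Sat-rename π φ (λ t → cong a (sym (ι≡s∘π t)))))
    where open SameOrderType same

module Independence (em : ExcludedMiddle 0ℓ) (G : OrderedAbelianGroup) where
  open OAG G hiding (_≤_)
  open OrderedAbelianGroupProperties G
  open ConvexSubgroups G
  open Definability em G
  open IncreasingTuples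
  open Indiscernibility G
  open IsLargestAvoiding using (avoids; largest)

  module Sequence (p : ℕ) (p-prime : Prime p) {H : Subset} (r : ℕ)
           (a : ℚ → Carrier) (indiscernible : Indiscernible a)
           (a-largest : ∀ i → IsLargestAvoiding (p ^ r) (a i) H)
           (differences-largest : ∀ {i j} → i ℚ.< j → IsLargestAvoiding p (a j - a i) H)
           where

    private instance
      p≢0 : NonZero p
      p≢0 = prime⇒nonZero p-prime

    cs : IsConvexSubgroup H
    cs = IsLargestAvoiding.isConvexSubgroup (a-largest 0ℚ)

    module H+pG = H+nG cs p

    a∈bracket : ∀ i → a i ∈ bracket H (p ^ r)
    a∈bracket i H' cs' _ H'⊈H with em {a i ∈ H' +mulG (p ^ r)}
    ... | yes a∈ = a∈
    ... | no a∉  = ⊥-elim (H'⊈H (largest (a-largest i) H' cs' a∉))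

    -- Membership in H + pG is definable from a u, a w for any u < w; with u < w above all indices,
    -- indiscernibility lets one index move up inside its gap.
    move-up-∈H+pG : ∀ k (ι : Fin k → ℚ) → Injective _≡_ _≡_ ι → ∀ t₀ → ∃ λ q → ι t₀ ℚ.< q ×
      ∀ (c : Fin k → ℤ) → sumFin k (λ t → c t ·ℤ a (ι t)) ∈ H +mulG p →
                          sumFin k (λ t → c t ·ℤ a (updateAt ι t₀ (const q) t)) ∈ H +mulG p
    move-up-∈H+pG k ι ι-injective t₀ with two-points-above ι ι-injective
    ... | u , w , u<w , uwι-injective with move-up (u ∷ w ∷ ι) uwι-injective (Fin.suc (Fin.suc t₀))
    ... | q , ιt₀<q , same = q , ιt₀<q , λ c Σ∈ →
      Equivalence.to (Sat-combinationᶠ p k c (a ∘ updateAt (u ∷ w ∷ ι) (Fin.suc (Fin.suc t₀)) (const q))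
                                       (differences-largest u<w))
      (Equivalence.to (Indiscernible⇒SameOrderType⇒⇔ {a} indiscernible same (combinationᶠ p k c))
      (Equivalence.from (Sat-combinationᶠ p k c (a ∘ (u ∷ w ∷ ι)) (differences-largest u<w)) Σ∈))

    independent-mod-p : ∀ k (ι : Fin k → ℚ) → Injective _≡_ _≡_ ι → ∀ (c : Fin k → ℤ) →
      sumFin k (λ t → c t ·ℤ a (ι t)) ∈ H +mulG p → ∀ t → p ℕd.∣ ℤ.∣ c t ∣
    independent-mod-p k ι ι-injective c Σ∈ t₀ with em {p ℕd.∣ ℤ.∣ c t₀ ∣}
    ... | yes p∣c = p∣c
    ... | no  p∤c = ⊥-elim (avoids (differences-largest ιt₀<q)
                                   (subst (H +mulG p) (-‿anti-homo-- _ _) (H+pG.neg-closed aιt₀-aq∈)))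
      where
      moved-up = move-up-∈H+pG k ι ι-injective t₀
      q : ℚ
      q = proj₁ moved-up
      ιt₀<q : ι t₀ ℚ.< q
      ιt₀<q = proj₁ (proj₂ moved-up)
      κ : Fin k → ℚ
      κ = updateAt ι t₀ (const q)
      moved : ∀ c → sumFin k (λ t → c t ·ℤ a (ι t)) ∈ H +mulG p →
                    sumFin k (λ t → c t ·ℤ a (κ t)) ∈ H +mulG p
      moved = proj₂ (proj₂ moved-up)
      difference : sumFin k (λ t → c t ·ℤ a (ι t)) - sumFin k (λ t → c t ·ℤ a (κ t)) ≡
                   c t₀ ·ℤ (a (ι t₀) - a q)
      difference = trans (sumFin-·ℤ-difference k c (a ∘ ι) (a ∘ κ) t₀ λ t t≢t₀ →
                            cong a (sym (updateAt-minimal t t₀ ι t≢t₀)))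
                         (cong (λ v → c t₀ ·ℤ (a (ι t₀) - a v)) (updateAt-updates t₀ ι))
      aιt₀-aq∈ : a (ι t₀) - a q ∈ H +mulG p
      aιt₀-aq∈ = H+pG.coprime-cancel p-prime {c t₀} p∤c
        (subst (H +mulG p) difference (H+pG.+-closed Σ∈ (H+pG.neg-closed (moved c Σ∈))))

    independent-mod-p^ : ∀ s k (ι : Fin k → ℚ) → Injective _≡_ _≡_ ι → ∀ (c : Fin k → ℤ) →
      sumFin k (λ t → c t ·ℤ a (ι t)) ∈ H +mulG (p ^ s) → ∀ t → p ^ s ℕd.∣ ℤ.∣ c t ∣
    independent-mod-p^ zero    k ι ι-injective c Σ∈ t = ℕd.1∣ _
    independent-mod-p^ (suc s) k ι ι-injective c Σ∈ t =
      subst (p ^ suc s ℕd.∣_) (sym (proj₁ (proj₂ (quotient t))))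
            (ℕd.*-monoˡ-∣ (p ^ s) (independent-mod-p k ι ι-injective e Σe∈ t))
      where
      quotient : ∀ t → ∃ λ e → ℤ.∣ c t ∣ ≡ ℤ.∣ e ∣ ℕ.* p ^ s ×
                               ∀ x → c t ·ℤ x ≡ (p ^ s) ·ℕ (e ·ℤ x)
      quotient t = ·ℤ-factor (p ^ s) (c t)
        (independent-mod-p^ s k ι ι-injective c (+mulG-∣ (^-monoʳ-∣ p (ℕP.n≤1+n s)) Σ∈) t)
      e : Fin k → ℤ
      e t = proj₁ (quotient t)
      Σc≡p^sΣe : sumFin k (λ t → c t ·ℤ a (ι t)) ≡ (p ^ s) ·ℕ sumFin k (λ t → e t ·ℤ a (ι t))
      Σc≡p^sΣe = trans (sumFin-cong k λ t → proj₂ (proj₂ (quotient t)) (a (ι t)))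
                       (sumFin-·ℕ (p ^ s) k _)
      Σe∈ : sumFin k (λ t → e t ·ℤ a (ι t)) ∈ H +mulG p
      Σe∈ = H+pG.·ℕ-cancel (p ^ s) {{ℕP.m^n≢0 p s}}
              (subst (λ n → (p ^ s) ·ℕ sumFin k (λ t → e t ·ℤ a (ι t)) ∈ H +mulG n)
                     (ℕP.*-comm p (p ^ s)) (subst (H +mulG (p ^ suc s)) Σc≡p^sΣe Σ∈))

    𝔰-combination : ∀ k (ι : Fin k → ℚ) → Injective _≡_ _≡_ ι → ∀ (m : Fin k → ℤ) →
      (∃ λ t → ValLt p (m t) r) → IsS (p ^ r) (sumFin k (λ t → m t ·ℤ a (ι t))) H
    𝔰-combination k ι ι-injective m (t , e , e<r , _ , p^[1+e]∤m) =
      IsLargestAvoiding⇒IsS {p ^ r} record { isConvexSubgroup = cs ; avoids = Σ∉ ; largest = Σ-largest }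
      where
      Σ : Carrier
      Σ = sumFin k (λ t → m t ·ℤ a (ι t))
      Σ∉ : Σ ∉ H +mulG (p ^ r)
      Σ∉ Σ∈ = p^[1+e]∤m (ℕd.∣-trans (^-monoʳ-∣ p e<r) (independent-mod-p^ r k ι ι-injective m Σ∈ t))
      Σ-largest : ∀ H' → IsConvexSubgroup H' → Σ ∉ H' +mulG (p ^ r) → H' ⊆ H
      Σ-largest H' cs' Σ∉H' {g} g∈H' with em {g ∈ H}
      ... | yes g∈H = g∈H
      ... | no  g∉H = ⊥-elim (Σ∉H' (H+nG.sumFin-closed cs' (p ^ r) k _ λ t →
              H+nG.·ℤ-closed cs' (p ^ r) (m t) {a (ι t)}
                (a∈bracket (ι t) H' cs' (⊆-of-witness cs cs' g∈H' g∉H)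
                                        (λ H'⊆H → g∉H (H'⊆H g∈H')))))

lemma3p6 : ExcludedMiddle (lsuc 0ℓ) →
    (G : OrderedAbelianGroup) → let open OAG G in
    (p : ℕ) → Prime p → (H : Subset) → InSn p H → Satisfiable H →
    (r : ℕ) → r ≥ 1 →
    (a : ℚ → Carrier) → Indiscernible a →
    (∀ i → IsS (p ^ r) (a i) H) →
    (∀ i j → i Data.Rational.< j → IsS p (a j + (- a i)) H) →
    (∀ i → a i ∈ bracket H (p ^ r))
    × (∀ (k : ℕ) (ι : Fin k → ℚ) → Injective _≡_ _≡_ ι →
         (∀ (c : Fin k → ℤ) → sumFin k (λ t → c t ·ℤ a (ι t)) ∈ (H +mulG p)
            → ∀ t → (+ p) ℤd.∣ c t)
       × (∀ (c : Fin k → ℤ) → sumFin k (λ t → c t ·ℤ a (ι t)) ∈ (H +mulG (p ^ r))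
            → ∀ t → (+ (p ^ r)) ℤd.∣ c t)
       × (∀ (m : Fin k → ℤ) → (∃ λ t → ValLt p (m t) r)
            → IsS (p ^ r) (sumFin k (λ t → m t ·ℤ a (ι t))) H))
lemma3p6 em G p p-prime H _ H≠∅ r _ a indiscernible a-S differences-S =
  a∈bracket , λ k ι ι-injective →
    independent-mod-p k ι ι-injective ,
    independent-mod-p^ r k ι ι-injective ,
    𝔰-combination k ι ι-injective
  where
  open ConvexSubgroups G using (IsS⇒IsLargestAvoiding)
  open Independence.Sequence (λ {A} → map′ lower lift (em {Lift (lsuc 0ℓ) A})) G
         p p-prime r a indiscernible (IsS⇒IsLargestAvoiding H≠∅ ∘ a-S)
         (λ {i} {j} i<j → IsS⇒IsLargestAvoiding H≠∅ (differences-S i j i<j))
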